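{- Let $\mathfrak Q,\mathfrak Q'$ be quasigroups and $\theta:\bar G(\mathfrak QK_3)\hookrightarrow\bar G(\mathfrak Q'K_3)$ a matroid monomorphism. If $\#\mathfrak Q>1$, then $\theta$ induces a unique biased-graph monomorphism $\theta':\langle\mathfrak QK_3\rangle\hookrightarrow\langle\mathfrak Q'K_3\rangle$ that agrees with $\theta$ on $E(\mathfrak QK_3)$. If $\#\mathfrak Q=1$, there is a biased-graph monomorphism $\langle\mathfrak QK_3\rangle\hookrightarrow\langle\mathfrak Q'K_3\rangle$ (not necessarily induced by $\theta$).
   Context: For a quasigroup $(\mathfrak Q,\cdot)$, $\langle\mathfrak QK_3\rangle$ is the biased graph with nodes $v_1,v_2,v_3$, links $ge_{ij}$ ($g\in\mathfrak Q$, $ij\in\{12,23,13\}$) joining $v_i,v_j$, and balanced circles exactly the triangles $\{ge_{12},he_{23},ke_{13}\}$ with $g\cdot h=k$; $E(\mathfrak QK_3)$ is its edge set. The full frame matroid $\bar G(\mathfrak QK_3)$ has ground set $E(\mathfrak QK_3)\cup\{d_1,d_2,d_3\}$, where $d_i$ is a half edge at $v_i$, and rank function $\operatorname{rk}S=3-b(S)$, where $b(S)$ is the number of connected components of $(\{v_1,v_2,v_3\},S)$ that are balanced (contain no half edge and only balanced circles). A matroid monomorphism is an injective map between ground sets preserving the rank of every subset. A biased-graph monomorphism is an injective map on nodes and edges preserving incidence that maps balanced circles to balanced circles and unbalanced circles to unbalanced circles. -}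

module Defs where

open import Level using (0ℓ; Lift) renaming (suc to lsuc)
open import Data.Nat using (ℕ; _∸_)
open import Data.Fin using (Fin; zero; suc; _≤_)
open import Data.Fin.Subset using (Subset; _∈_; ∣_∣)
open import Data.Product using (Σ; ∃; _×_; _,_; proj₁; proj₂)
open import Data.Sum using (_⊎_; inj₁; inj₂)
open import Relation.Nullary using (¬_)
open import Relation.Unary using (Pred; _⊆_; _≐_)
open import Relation.Binary.PropositionalEquality using (_≡_; _≢_)
open import Relation.Binary.Construct.Closure.ReflexiveTransitive using (Star)
open import Function.Definitions using (Injective)
import Algebra.Structures as AS
open import Algebra.Core using (Op₂)

record QG : Set₁ where
  field
    Carrier      : Set
    _·_          : Op₂ Carrier
    _\\_         : Op₂ Carrier
    _//_         : Op₂ Carrier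
    isQuasigroup : AS.IsQuasigroup {A = Carrier} _≡_ _·_ _\\_ _//_

open QG public using (Carrier)

MoreThanOne : QG → Set
MoreThanOne Q = Σ (Carrier Q) λ a → Σ (Carrier Q) λ b → a ≢ b

ExactlyOne : QG → Set
ExactlyOne Q = Σ (Carrier Q) λ a → ∀ b → b ≡ a

data Pair : Set where
  p12 p23 p13 : Pair

v₁ v₂ v₃ : Fin 3
v₁ = zero
v₂ = suc zero
v₃ = suc (suc zero)

ends : Pair → Fin 3 × Fin 3
ends p12 = v₁ , v₂
ends p23 = v₂ , v₃
ends p13 = v₁ , v₃

data Edge (Q : QG) : Set where
  e : Carrier Q → Pair → Edge Q

endsE : {Q : QG} → Edge Q → Fin 3 × Fin 3
endsE (e g p) = ends p

Inc : {Q : QG} → Edge Q → Fin 3 → Set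
Inc x v = (proj₁ (endsE x) ≡ v) ⊎ (proj₂ (endsE x) ≡ v)

Circle : (Q : QG) → Pred (Edge Q) 0ℓ → Set
Circle Q C =
    (Σ (Carrier Q) λ g → Σ (Carrier Q) λ h → Σ Pair λ p →
       g ≢ h × (C ≐ λ x → (x ≡ e g p) ⊎ (x ≡ e h p)))
  ⊎ (Σ (Carrier Q) λ g → Σ (Carrier Q) λ h → Σ (Carrier Q) λ k →
       (C ≐ λ x → (x ≡ e g p12) ⊎ (x ≡ e h p23) ⊎ (x ≡ e k p13)))

BalancedCircle : (Q : QG) → Pred (Edge Q) 0ℓ → Set
BalancedCircle Q C =
  Σ (Carrier Q) λ g → Σ (Carrier Q) λ h → Σ (Carrier Q) λ k →
    (QG._·_ Q g h ≡ k) ×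
    (C ≐ λ x → (x ≡ e g p12) ⊎ (x ≡ e h p23) ⊎ (x ≡ e k p13))

-- The full frame matroid Ḡ(Q K₃): ground set E(QK₃) ∪ {d₁,d₂,d₃};
-- inj₂ i is the half edge d_i at node i.

Ground : QG → Set
Ground Q = Edge Q ⊎ Fin 3

Adj : (Q : QG) → Pred (Ground Q) 0ℓ → Fin 3 → Fin 3 → Set
Adj Q S v w = Σ (Edge Q) λ x → S (inj₁ x) × ((endsE x ≡ (v , w)) ⊎ (endsE x ≡ (w , v)))

Conn : (Q : QG) → Pred (Ground Q) 0ℓ → Fin 3 → Fin 3 → Set
Conn Q S = Star (Adj Q S)

BalancedComp : (Q : QG) → Pred (Ground Q) 0ℓ → Fin 3 → Set₁
BalancedComp Q S v =
  (∀ i → S (inj₂ i) → ¬ Conn Q S v i) ×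
  (∀ (C : Pred (Edge Q) 0ℓ) → Circle Q C → (∀ x → C x → S (inj₁ x)) →
     (Σ (Edge Q) λ x → Σ (Fin 3) λ w → C x × Inc x w × Conn Q S v w) →
     BalancedCircle Q C)

-- v is the (least) representative node of its component
IsRep : (Q : QG) → Pred (Ground Q) 0ℓ → Fin 3 → Set
IsRep Q S v = ∀ w → Conn Q S v w → v ≤ w

HasCount : Pred (Fin 3) (lsuc 0ℓ) → ℕ → Set₁
HasCount P n = Σ (Subset 3) λ s → (∀ v → (v ∈ s → P v) × (P v → v ∈ s)) × (∣ s ∣ ≡ n)

NumBalComps : (Q : QG) → Pred (Ground Q) 0ℓ → ℕ → Set₁
NumBalComps Q S n = HasCount (λ v → Lift (lsuc 0ℓ) (IsRep Q S v) × BalancedComp Q S v) n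

HasRank : (Q : QG) → Pred (Ground Q) 0ℓ → ℕ → Set₁
HasRank Q S r = Σ ℕ λ n → NumBalComps Q S n × (r ≡ 3 ∸ n)

image : {A B : Set} → (A → B) → Pred A 0ℓ → Pred B 0ℓ
image f S y = Σ _ λ x → S x × (f x ≡ y)

MatroidMono : (Q Q' : QG) → (Ground Q → Ground Q') → Set₁
MatroidMono Q Q' θ =
  Injective _≡_ _≡_ θ ×
  (∀ (S : Pred (Ground Q) 0ℓ) (r : ℕ) →
     (HasRank Q S r → HasRank Q' (image θ S) r) ×
     (HasRank Q' (image θ S) r → HasRank Q S r))

record BGMono (Q Q' : QG) : Set₁ where
  field
    node     : Fin 3 → Fin 3
    edge     : Edge Q → Edge Q'
    node-inj : Injective _≡_ _≡_ node
    edge-inj : Injective _≡_ _≡_ edge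
    incid    : ∀ x v → Inc x v → Inc (edge x) (node v)
    bal      : ∀ C → Circle Q C → BalancedCircle Q C → BalancedCircle Q' (image edge C)
    unbal    : ∀ C → Circle Q C → ¬ BalancedCircle Q C → ¬ BalancedCircle Q' (image edge C)

Agrees : {Q Q' : QG} → (Ground Q → Ground Q') → BGMono Q Q' → Set
Agrees θ φ = ∀ x → θ (inj₁ x) ≡ inj₁ (BGMono.edge φ x)

SameMono : {Q Q' : QG} → BGMono Q Q' → BGMono Q Q' → Set
SameMono φ ψ = (∀ v → BGMono.node φ v ≡ BGMono.node ψ v) ×
               (∀ x → BGMono.edge φ x ≡ BGMono.edge ψ x)

module Submission where

open import Defs
open import Data.Product using (Σ; _×_)

-- Every set the proof examines has at most four elements, and whether three
-- elements of Ḡ(QK₃) are dependent is decided by their shapes (a half edge at a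
-- node, or a link on a pair of nodes) together with the balance of triangles.
-- So the combinatorial facts about shapes are decided once and for all by
-- exhaustive evaluation of Boolean formulas.
--
-- For #Q > 1 (module Image.Induced) the ranks of {d_i, d_j, a e_ij},
-- {d_i, a e_ij, b e_ij} and {d₁, d₂, d₃}, preserved by θ, force θ to send half
-- edges to half edges (the node map) and each link g e_ij to a link joining the
-- image nodes (the edge map).  Balanced and unbalanced triangles have ranks 2
-- and 3, and digons go to parallel links, so balance is preserved both ways.
-- Uniqueness holds because a monomorphism is determined by its links.  For
-- #Q = 1 only an element of Q' is needed, found by pigeonhole among the images
-- of d₁, d₂, d₃ and a link.

open import Level using (0ℓ; Lift; lift) renaming (suc to lsuc)
open import Data.Bool using (Bool; true; false; T; not; _∧_; _∨_)
open import Data.Bool.Properties using (T-∧; T-∨)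
open import Data.Empty using (⊥-elim)
open import Data.Fin using (Fin; zero; suc; _≤_)
open import Data.Fin.Properties using (_≟_; ≤-reflexive; any?; pigeonhole; <⇒≢)
open import Data.Fin.Subset using (⁅_⁆; ∣_∣; _-_) renaming (⊥ to ∅; _∈_ to _∈ₛ_)
open import Data.Fin.Subset.Properties
  using (∉⊥; ∣⊥∣≡0; x∈⁅x⁆; x∈⁅y⁆⇒x≡y; ∣⁅x⁆∣≡1; x∈p⇒∣p-x∣<∣p∣; nonempty?; Empty-unique)
open import Data.Nat using (suc; _<_; z≤n)
open import Data.Nat.Properties using (n≮0; 0≢1+n; n<1+n)
open import Data.Product using (∃; _,_; proj₁; proj₂)
open import Data.Sum using (_⊎_; inj₁; inj₂)
open import Data.Sum.Properties using (inj₁-injective; inj₂-injective)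
open import Function using (_∘_)
open import Function.Bundles using (Equivalence)
open import Function.Definitions using (Injective)
open import Relation.Binary.Construct.Closure.ReflexiveTransitive using (ε; _◅_; _◅◅_)
open import Relation.Binary.Definitions using (DecidableEquality)
open import Relation.Binary.PropositionalEquality
open import Relation.Nullary using (¬_; Dec; yes; no)
open import Relation.Nullary.Decidable
  using (⌊_⌋; _⊎-dec_; toWitness; fromWitness; toWitnessFalse; fromWitnessFalse)
open import Relation.Unary using (Pred; _⊆_; _≐_)

both : ∀ {a b} → T a → T b → T (a ∧ b)
both p q = Equivalence.from T-∧ (p , q)

split-∧ : ∀ {a b} → T (a ∧ b) → T a × T b
split-∧ = Equivalence.to T-∧

split-∨ : ∀ {a b} → T (a ∨ b) → T a ⊎ T b
split-∨ = Equivalence.to T-∨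

infixr 1 _⇒_
_⇒_ : Bool → Bool → Bool
a ⇒ b = not a ∨ b

modus-ponens : ∀ {a b} → T (a ⇒ b) → T a → T b
modus-ponens {true} t _ = t

refute : ∀ {b} → T (not b) → ¬ T b
refute {false} _ ()

affirm-not : ∀ {b} → ¬ T b → T (not b)
affirm-not {false} _ = _
affirm-not {true} ¬t = ¬t _

record Enumerable (X : Set) : Set where
  field
    every       : (X → Bool) → Bool
    every-sound : ∀ f → T (every f) → ∀ x → T (f x)
open Enumerable {{...}}

record Searchable (X : Set) : Set where
  field
    some       : (X → Bool) → Bool
    some-sound : ∀ f → T (some f) → ∃ λ x → T (f x)
open Searchable {{...}}

record Exhaustive (A : Set) : Set₁ where
  field
    Holds : A → Set
    check : A → Bool
    sound : ∀ f → T (check f) → Holds f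
open Exhaustive {{...}}

byExhaustion : ∀ {A} {{_ : Exhaustive A}} (f : A) → {T (check f)} → Holds f
byExhaustion f {t} = sound f t

instance
  booleanExhaustive : Exhaustive Bool
  booleanExhaustive .Holds = T
  booleanExhaustive .check b = b
  booleanExhaustive .sound _ t = t

  quantifiedExhaustive : ∀ {X A} → {{Enumerable X}} → {{Exhaustive A}} → Exhaustive (X → A)
  quantifiedExhaustive .Holds f = ∀ x → Holds (f x)
  quantifiedExhaustive .check f = every (λ x → check (f x))
  quantifiedExhaustive .sound f t x = sound (f x) (every-sound _ t x)

  nodesEnumerable : Enumerable (Fin 3)
  nodesEnumerable .every f = f v₁ ∧ f v₂ ∧ f v₃
  nodesEnumerable .every-sound f t zero = proj₁ (split-∧ t)
  nodesEnumerable .every-sound f t (suc zero) = proj₁ (split-∧ {f v₂} (proj₂ (split-∧ {f v₁} t)))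
  nodesEnumerable .every-sound f t (suc (suc zero)) = proj₂ (split-∧ {f v₂} (proj₂ (split-∧ {f v₁} t)))

  nodesSearchable : Searchable (Fin 3)
  nodesSearchable .some f = f v₁ ∨ f v₂ ∨ f v₃
  nodesSearchable .some-sound f t with split-∨ {f v₁} t
  ... | inj₁ t₁ = v₁ , t₁
  ... | inj₂ t' with split-∨ {f v₂} t'
  ... | inj₁ t₂ = v₂ , t₂
  ... | inj₂ t₃ = v₃ , t₃

  pairsEnumerable : Enumerable Pair
  pairsEnumerable .every f = f p12 ∧ f p23 ∧ f p13
  pairsEnumerable .every-sound f t p12 = proj₁ (split-∧ {f p12} t)
  pairsEnumerable .every-sound f t p23 = proj₁ (split-∧ {f p23} (proj₂ (split-∧ {f p12} t)))
  pairsEnumerable .every-sound f t p13 = proj₂ (split-∧ {f p23} (proj₂ (split-∧ {f p12} t)))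

  pairsSearchable : Searchable Pair
  pairsSearchable .some f = f p12 ∨ f p23 ∨ f p13
  pairsSearchable .some-sound f t with split-∨ {f p12} t
  ... | inj₁ t₁ = p12 , t₁
  ... | inj₂ t' with split-∨ {f p23} t'
  ... | inj₁ t₂ = p23 , t₂
  ... | inj₂ t₃ = p13 , t₃

-- Pairs of nodes and their endpoints.  Endpoint p v is definitionally
-- Inc (e g p) v, so the Boolean test below also decides incidence.

first second : Pair → Fin 3
first p = proj₁ (ends p)
second p = proj₂ (ends p)

Endpoint : Pair → Fin 3 → Set
Endpoint p v = (first p ≡ v) ⊎ (second p ≡ v)

endpoint? : ∀ p v → Dec (Endpoint p v)
endpoint? p v = (first p ≟ v) ⊎-dec (second p ≟ v)

endpoint : Pair → Fin 3 → Bool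
endpoint p v = ⌊ endpoint? p v ⌋

endpoint-sound : ∀ {p v} → T (endpoint p v) → Endpoint p v
endpoint-sound {p} {v} = toWitness {a? = endpoint? p v}

endpoint-complete : ∀ {p v} → Endpoint p v → T (endpoint p v)
endpoint-complete {p} {v} = fromWitness {a? = endpoint? p v}

_≟ₚ_ : DecidableEquality Pair
p12 ≟ₚ p12 = yes refl
p12 ≟ₚ p23 = no λ ()
p12 ≟ₚ p13 = no λ ()
p23 ≟ₚ p12 = no λ ()
p23 ≟ₚ p23 = yes refl
p23 ≟ₚ p13 = no λ ()
p13 ≟ₚ p12 = no λ ()
p13 ≟ₚ p23 = no λ ()
p13 ≟ₚ p13 = yes refl

third : Pair → Fin 3
third p12 = v₃
third p23 = v₁
third p13 = v₂

distinctNodes : Fin 3 → Fin 3 → Fin 3 → Bool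
distinctNodes a b c = not ⌊ a ≟ b ⌋ ∧ not ⌊ a ≟ c ⌋ ∧ not ⌊ b ≟ c ⌋

distinctPairs : Pair → Pair → Pair → Bool
distinctPairs p q r = not ⌊ p ≟ₚ q ⌋ ∧ not ⌊ q ≟ₚ r ⌋ ∧ not ⌊ p ≟ₚ r ⌋

-- The shape of an element of Ḡ(QK₃) forgets the group label of a
-- link and remembers only where it sits; every combinatorial fact about ranks
-- of at most four elements that the proof needs is a fact about shapes.

data Shape : Set where
  half : Fin 3 → Shape
  link : Pair → Shape

instance
  shapesEnumerable : Enumerable Shape
  shapesEnumerable .every f = every (λ i → f (half i)) ∧ every (λ p → f (link p))
  shapesEnumerable .every-sound f t (half i) =
    every-sound (λ i → f (half i)) (proj₁ (split-∧ {every (λ i → f (half i))} t)) i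
  shapesEnumerable .every-sound f t (link p) =
    every-sound (λ p → f (link p)) (proj₂ (split-∧ {every (λ i → f (half i))} t)) p

isHalf : Shape → Bool
isHalf (half _) = true
isHalf (link _) = false

-- the shapes of two distinct elements are apart: distinct half edges sit at
-- distinct nodes, while links of one shape may differ in their labels
apart : Shape → Shape → Bool
apart (half i) (half j) = not ⌊ i ≟ j ⌋
apart _ _ = true

touches : Shape → Fin 3 → Bool
touches (half i) v = ⌊ i ≟ v ⌋
touches (link p) v = endpoint p v

joins : Shape → Fin 3 → Fin 3 → Bool
joins (half _) v w = false
joins (link p) v w = endpoint p v ∧ endpoint p w

-- the lines of Ḡ(QK₃): for each pair, the two half edges at its ends and its links
onLine : Pair → Shape → Bool
onLine P (half i) = endpoint P i
onLine P (link p) = ⌊ p ≟ₚ P ⌋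

coline : Shape → Shape → Bool
coline s t = some λ P → onLine P s ∧ onLine P t

collinear : Shape → Shape → Shape → Bool
collinear s t u = some λ P → onLine P s ∧ onLine P t ∧ onLine P u

triangle : Shape → Shape → Shape → Bool
triangle (link p) (link q) (link r) = distinctPairs p q r
triangle _ _ _ = false

-- the shapes a dependent triple of a frame matroid on three nodes can have
dependent : Shape → Shape → Shape → Bool
dependent s t u = collinear s t u ∨ triangle s t u

-- The graph formed by three shapes: its connectivity, and the defects
-- (half edges and digons) that prevent a component from being balanced.

halfAt : Shape → Fin 3 → Bool
halfAt (half i) v = ⌊ i ≟ v ⌋
halfAt (link _) v = false

digonAt : Shape → Shape → Fin 3 → Bool
digonAt (link p) (link q) v = ⌊ p ≟ₚ q ⌋ ∧ endpoint p v
digonAt _ _ v = false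

adjacent : Shape → Shape → Shape → Fin 3 → Fin 3 → Bool
adjacent s t u v w = joins s v w ∨ joins t v w ∨ joins u v w

connected : Shape → Shape → Shape → Fin 3 → Fin 3 → Bool
connected s t u v w =
  ⌊ v ≟ w ⌋ ∨ adjacent s t u v w ∨ some (λ m → adjacent s t u v m ∧ adjacent s t u m w)

defectAt : Shape → Shape → Shape → Fin 3 → Bool
defectAt s t u w =
  halfAt s w ∨ halfAt t w ∨ halfAt u w ∨ digonAt s t w ∨ digonAt s u w ∨ digonAt t u w

reachesDefect : Shape → Shape → Shape → Fin 3 → Bool
reachesDefect s t u v = some λ w → connected s t u v w ∧ defectAt s t u w

independent-unless-dependent : ∀ s t u v →
  T (apart s t ∧ apart s u ∧ apart t u ⇒ reachesDefect s t u v ∨ dependent s t u)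
independent-unless-dependent = byExhaustion λ s t u v →
  apart s t ∧ apart s u ∧ apart t u ⇒ reachesDefect s t u v ∨ dependent s t u

dependent-triples-coline : ∀ s t u w →
  T (apart s t ∧ apart s u ∧ apart s w ∧ dependent s t u ∧ dependent s t w ∧ dependent s u w ⇒ coline s t)
dependent-triples-coline = byExhaustion λ s t u w →
  apart s t ∧ apart s u ∧ apart s w ∧ dependent s t u ∧ dependent s t w ∧ dependent s u w ⇒ coline s t

pairwise-coline-halves : ∀ s t u →
  T (coline s t ∧ coline s u ∧ coline t u ∧ not (collinear s t u) ⇒ isHalf s ∧ isHalf t ∧ isHalf u)
pairwise-coline-halves = byExhaustion λ s t u →
  coline s t ∧ coline s u ∧ coline t u ∧ not (collinear s t u) ⇒ isHalf s ∧ isHalf t ∧ isHalf u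

dependent-on-halves-joins : ∀ i j s →
  T (not ⌊ i ≟ j ⌋ ∧ apart (half i) s ∧ apart (half j) s ∧ dependent (half i) (half j) s ⇒ joins s i j)
dependent-on-halves-joins = byExhaustion λ i j s →
  not ⌊ i ≟ j ⌋ ∧ apart (half i) s ∧ apart (half j) s ∧ dependent (half i) (half j) s ⇒ joins s i j

links-around-not-collinear : ∀ a b c p q r →
  T (distinctNodes a b c ∧ joins (link p) a b ∧ joins (link q) b c ∧ joins (link r) a c ⇒
     not (collinear (link p) (link q) (link r)))
links-around-not-collinear = byExhaustion λ a b c p q r →
  distinctNodes a b c ∧ joins (link p) a b ∧ joins (link q) b c ∧ joins (link r) a c ⇒
  not (collinear (link p) (link q) (link r))

pair-determined : ∀ a b p q → T (not ⌊ a ≟ b ⌋ ∧ joins (link p) a b ∧ joins (link q) a b ⇒ ⌊ p ≟ₚ q ⌋)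
pair-determined = byExhaustion λ a b p q →
  not ⌊ a ≟ b ⌋ ∧ joins (link p) a b ∧ joins (link q) a b ⇒ ⌊ p ≟ₚ q ⌋

links-meet-once : ∀ a b c w p q →
  T (distinctNodes a b c ∧ joins (link p) a b ∧ joins (link q) a c ∧ endpoint p w ∧ endpoint q w ⇒ ⌊ w ≟ a ⌋)
links-meet-once = byExhaustion λ a b c w p q →
  distinctNodes a b c ∧ joins (link p) a b ∧ joins (link q) a c ∧ endpoint p w ∧ endpoint q w ⇒ ⌊ w ≟ a ⌋

line-avoids-third : ∀ P s → T (onLine P s ⇒ not (touches s (third P)))
line-avoids-third = byExhaustion λ P s → onLine P s ⇒ not (touches s (third P))

endpoint-unless-third : ∀ p v → T (⌊ v ≟ third p ⌋ ∨ endpoint p v)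
endpoint-unless-third = byExhaustion λ p v → ⌊ v ≟ third p ⌋ ∨ endpoint p v

Triple : {A : Set} → A → A → A → Pred A 0ℓ
Triple a b c w = (w ≡ a) ⊎ (w ≡ b) ⊎ (w ≡ c)

pair : {Q : QG} → Edge Q → Pair
pair (e _ p) = p

label : {Q : QG} → Edge Q → Carrier Q
label (e g _) = g

shape : {Q : QG} → Ground Q → Shape
shape (inj₁ x) = link (pair x)
shape (inj₂ i) = half i

distinct-apart : ∀ {Q} (z z' : Ground Q) → z ≢ z' → T (apart (shape z) (shape z'))
distinct-apart (inj₂ i) (inj₂ j) z≢z' = fromWitnessFalse (z≢z' ∘ cong inj₂)
distinct-apart (inj₂ _) (inj₁ _) _ = _
distinct-apart (inj₁ _) _ _ = _

half-shape : ∀ {Q} (z : Ground Q) → T (isHalf (shape z)) → ∃ λ i → z ≡ inj₂ i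
half-shape (inj₂ i) _ = i , refl
half-shape (inj₁ _) ()

joining-shape : ∀ {Q} (z : Ground Q) {v w} → T (joins (shape z) v w) →
  ∃ λ x → (z ≡ inj₁ x) × Inc x v × Inc x w
joining-shape (inj₁ (e g p)) {v} t = let tv , tw = split-∧ {endpoint p v} t in
  e g p , refl , endpoint-sound {p} tv , endpoint-sound {p} tw
joining-shape (inj₂ _) ()


incident-endpoint : ∀ {Q} (x : Edge Q) {v} → Inc x v → T (endpoint (pair x) v)
incident-endpoint (e _ p) = endpoint-complete {p}

ends-distinct : ∀ p → first p ≢ second p
ends-distinct p12 ()
ends-distinct p23 ()
ends-distinct p13 ()

distinct-image : ∀ {f : Fin 3 → Fin 3} → Injective _≡_ _≡_ f →
  ∀ a b c → T (distinctNodes a b c) → T (distinctNodes (f a) (f b) (f c))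
distinct-image {f} f-inj a b c t =
  let ab , t' = split-∧ {not ⌊ a ≟ b ⌋} t
      ac , bc = split-∧ {not ⌊ a ≟ c ⌋} t'
      keep : ∀ {u w} → T (not ⌊ u ≟ w ⌋) → T (not ⌊ f u ≟ f w ⌋)
      keep {u} {w} d = fromWitnessFalse (toWitnessFalse {a? = u ≟ w} d ∘ f-inj)
  in both (keep ab) (both (keep ac) (keep bc))

swap₁₂ : {A : Set} {a b c : A} → Triple a b c ≐ Triple b a c
swap₁₂ = swap , swap
  where
    swap : ∀ {X Y Z : Set} → X ⊎ Y ⊎ Z → Y ⊎ X ⊎ Z
    swap (inj₁ x) = inj₂ (inj₁ x)
    swap (inj₂ (inj₁ y)) = inj₁ y
    swap (inj₂ (inj₂ z)) = inj₂ (inj₂ z)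

swap₂₃ : {A : Set} {a b c : A} → Triple a b c ≐ Triple a c b
swap₂₃ = swap , swap
  where
    swap : ∀ {X Y Z : Set} → X ⊎ Y ⊎ Z → X ⊎ Z ⊎ Y
    swap (inj₁ x) = inj₁ x
    swap (inj₂ (inj₁ y)) = inj₂ (inj₂ y)
    swap (inj₂ (inj₂ z)) = inj₂ (inj₁ z)

infixr 4 _⨾_
_⨾_ : {A : Set} {P R U : Pred A 0ℓ} → P ≐ R → R ≐ U → P ≐ U
(P⊆R , R⊆P) ⨾ (R⊆U , U⊆R) = (λ m → R⊆U (P⊆R m)) , (λ m → R⊆P (U⊆R m))

image-triple : {A B : Set} (f : A → B) {C : Pred A 0ℓ} {a b c : A} →
  C ≐ Triple a b c → image f C ≐ Triple (f a) (f b) (f c)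
image-triple f {C} {a} {b} {c} (C⊆T , T⊆C) = into , onto
  where
    into : image f C ⊆ Triple (f a) (f b) (f c)
    into (x , Cx , fx≡w) with C⊆T {x} Cx
    ... | inj₁ refl = inj₁ (sym fx≡w)
    ... | inj₂ (inj₁ refl) = inj₂ (inj₁ (sym fx≡w))
    ... | inj₂ (inj₂ refl) = inj₂ (inj₂ (sym fx≡w))
    onto : Triple (f a) (f b) (f c) ⊆ image f C
    onto (inj₁ refl) = _ , T⊆C (inj₁ refl) , refl
    onto (inj₂ (inj₁ refl)) = _ , T⊆C (inj₂ (inj₁ refl)) , refl
    onto (inj₂ (inj₂ refl)) = _ , T⊆C (inj₂ (inj₂ refl)) , refl

≐-refl : {A : Set} {P : Pred A 0ℓ} → P ≐ P
≐-refl = (λ m → m) , (λ m → m)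

≐-sym : {A : Set} {P R : Pred A 0ℓ} → P ≐ R → R ≐ P
≐-sym (P⊆R , R⊆P) = R⊆P , P⊆R

inj₁-triple : {A B : Set} {a b c x : A} → Triple a b c x → Triple {A ⊎ B} (inj₁ a) (inj₁ b) (inj₁ c) (inj₁ x)
inj₁-triple (inj₁ refl) = inj₁ refl
inj₁-triple (inj₂ (inj₁ refl)) = inj₂ (inj₁ refl)
inj₁-triple (inj₂ (inj₂ refl)) = inj₂ (inj₂ refl)

module Frame (Q : QG) where
  open QG Q using (_·_)

  -- v is the least node of a balanced component of ({v₁,v₂,v₃}, S); the rank
  -- of S is 3 minus the number of good nodes
  record Good (S : Pred (Ground Q) 0ℓ) (v : Fin 3) : Set₁ where
    constructor good
    field
      least-node : IsRep Q S v
      balanced   : BalancedComp Q S v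

  counted : ∀ {S v} → Good S v → Lift (lsuc 0ℓ) (IsRep Q S v) × BalancedComp Q S v
  counted (good rep bc) = lift rep , bc

  uncounted : ∀ {S v} → Lift (lsuc 0ℓ) (IsRep Q S v) × BalancedComp Q S v → Good S v
  uncounted (lift rep , bc) = good rep bc

  rank-3 : ∀ S → (∀ v → ¬ Good S v) → HasRank Q S 3
  rank-3 S none =
    0 , (∅ , (λ v → (λ v∈∅ → ⊥-elim (∉⊥ v∈∅)) , (λ c → ⊥-elim (none v (uncounted c)))) , ∣⊥∣≡0 3) , refl

  rank-2 : ∀ S k → Good S k → (∀ v → v ≢ k → ¬ Good S v) → HasRank Q S 2
  rank-2 S k good-k others =
    1 , (⁅ k ⁆ , (λ v → (λ v∈k → counted (subst (Good S) (sym (x∈⁅y⁆⇒x≡y k v∈k)) good-k)) , only v) ,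
         ∣⁅x⁆∣≡1 k) , refl
    where
      only : ∀ v → Lift (lsuc 0ℓ) (IsRep Q S v) × BalancedComp Q S v → v ∈ₛ ⁅ k ⁆
      only v c with v ≟ k
      ... | yes refl = x∈⁅x⁆ v
      ... | no v≢k = ⊥-elim (others v v≢k (uncounted c))

  rank-3-none : ∀ {S v} → HasRank Q S 3 → ¬ Good S v
  rank-3-none {v = v} (0 , (s , members , size) , _) good-v =
    n≮0 (subst (∣ s - v ∣ <_) size (x∈p⇒∣p-x∣<∣p∣ (proj₂ (members v) (counted good-v))))
  rank-3-none (1 , _ , ())
  rank-3-none (2 , _ , ())
  rank-3-none (3 , _ , ())
  rank-3-none (suc (suc (suc (suc _))) , _ , ())

  rank-2-some : ∀ {S} → HasRank Q S 2 → ∃ (Good S)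
  rank-2-some (1 , (s , members , size) , _) with nonempty? s
  ... | yes (v , v∈s) = v , uncounted (proj₁ (members v) v∈s)
  ... | no empty = ⊥-elim (0≢1+n (trans (sym (∣⊥∣≡0 3)) (subst (λ t → ∣ t ∣ ≡ 1) (Empty-unique empty) size)))
  rank-2-some (0 , _ , ())
  rank-2-some (2 , _ , ())
  rank-2-some (3 , _ , ())
  rank-2-some (suc (suc (suc (suc _))) , _ , ())

  half-blocks : ∀ {S v i} → Good S v → S (inj₂ i) → ¬ Conn Q S v i
  half-blocks (good _ (no-half , _)) Si = no-half _ Si

  least : ∀ {S v w} → Good S v → Conn Q S v w → v ≤ w
  least (good rep _) = rep _

  incident-conn : ∀ S {x v w} → S (inj₁ x) → Inc x v → Inc x w → Conn Q S v w
  incident-conn S Sx (inj₁ refl) (inj₁ refl) = ε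
  incident-conn S Sx (inj₁ refl) (inj₂ refl) = (_ , Sx , inj₁ refl) ◅ ε
  incident-conn S Sx (inj₂ refl) (inj₁ refl) = (_ , Sx , inj₂ refl) ◅ ε
  incident-conn S Sx (inj₂ refl) (inj₂ refl) = ε

  isolated-good : ∀ S w → (∀ z → S z → ¬ T (touches (shape z) w)) → Good S w
  isolated-good S w untouched = good
    (λ u c → ≤-reflexive (sym (stays c)))
    ( (λ i Si c → untouched _ Si (fromWitness {a? = i ≟ w} (stays c)))
    , (λ C _ sub (x , u , Cx , inc , c) → ⊥-elim (untouched _ (sub x Cx) (incident-endpoint x (subst (Inc x) (stays c) inc)))))
    where
      stays : ∀ {u} → Conn Q S w u → u ≡ w
      stays ε = refl
      stays ((x , Sx , inj₁ refl) ◅ _) = ⊥-elim (untouched _ Sx (incident-endpoint x (inj₁ refl)))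
      stays ((x , Sx , inj₂ refl) ◅ _) = ⊥-elim (untouched _ Sx (incident-endpoint x (inj₂ refl)))

  Digon : Carrier Q → Carrier Q → Pair → Pred (Edge Q) 0ℓ
  Digon a b p x = (x ≡ e a p) ⊎ (x ≡ e b p)

  digon-unbalanced : ∀ {a b p} → ¬ BalancedCircle Q (Digon a b p)
  digon-unbalanced (g , h , _ , _ , _ , in-digon) =
    p12≢p23 (trans (on-p (in-digon (inj₁ refl))) (sym (on-p (in-digon (inj₂ (inj₁ refl))))))
    where
      on-p : ∀ {a b p x} → Digon a b p x → pair x ≡ p
      on-p (inj₁ refl) = refl
      on-p (inj₂ refl) = refl
      p12≢p23 : p12 ≢ p23
      p12≢p23 ()

  balanced-resp : ∀ {C D : Pred (Edge Q) 0ℓ} → C ≐ D → BalancedCircle Q C → BalancedCircle Q D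
  balanced-resp (C⊆D , D⊆C) (g , h , k , gh≡k , C≐T) = g , h , k , gh≡k , ((D⊆C , C⊆D) ⨾ C≐T)

  digon-blocks : ∀ {S v u a b p} → Good S v → S (inj₁ (e a p)) → S (inj₁ (e b p)) → a ≢ b →
    Conn Q S v u → ¬ Endpoint p u
  digon-blocks {S} {u = u} {a} {b} {p} (good _ (_ , balanced)) Sa Sb a≢b c at-u =
    digon-unbalanced (balanced (Digon a b p) is-circle in-S (e a p , u , inj₁ refl , at-u , c))
    where
      is-circle : Circle Q (Digon a b p)
      is-circle = inj₁ (a , b , p , a≢b , (λ m → m) , (λ m → m))
      in-S : ∀ x → Digon a b p x → S (inj₁ x)
      in-S _ (inj₁ refl) = Sa
      in-S _ (inj₂ refl) = Sb

  triangle-circle : ∀ (x y z : Edge Q) → T (distinctPairs (pair x) (pair y) (pair z)) →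
    ∃ λ g → ∃ λ h → ∃ λ k → Triple x y z ≐ Triple (e g p12) (e h p23) (e k p13)
  triangle-circle (e g p12) (e h p23) (e k p13) _ = g , h , k , ≐-refl
  triangle-circle (e g p12) (e k p13) (e h p23) _ = g , h , k , swap₂₃
  triangle-circle (e h p23) (e g p12) (e k p13) _ = g , h , k , swap₁₂
  triangle-circle (e h p23) (e k p13) (e g p12) _ = g , h , k , swap₂₃ ⨾ swap₁₂
  triangle-circle (e k p13) (e g p12) (e h p23) _ = g , h , k , swap₁₂ ⨾ swap₂₃
  triangle-circle (e k p13) (e h p23) (e g p12) _ = g , h , k , swap₁₂ ⨾ swap₂₃ ⨾ swap₁₂
  triangle-circle (e _ p12) (e _ p12) _ ()
  triangle-circle (e _ p23) (e _ p23) _ ()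
  triangle-circle (e _ p13) (e _ p13) _ ()
  triangle-circle (e _ p12) (e _ p23) (e _ p12) ()
  triangle-circle (e _ p12) (e _ p23) (e _ p23) ()
  triangle-circle (e _ p12) (e _ p13) (e _ p12) ()
  triangle-circle (e _ p12) (e _ p13) (e _ p13) ()
  triangle-circle (e _ p23) (e _ p12) (e _ p12) ()
  triangle-circle (e _ p23) (e _ p12) (e _ p23) ()
  triangle-circle (e _ p23) (e _ p13) (e _ p13) ()
  triangle-circle (e _ p23) (e _ p13) (e _ p23) ()
  triangle-circle (e _ p13) (e _ p12) (e _ p12) ()
  triangle-circle (e _ p13) (e _ p12) (e _ p13) ()
  triangle-circle (e _ p13) (e _ p23) (e _ p13) ()
  triangle-circle (e _ p13) (e _ p23) (e _ p23) ()

  -- a triangle of S is balanced when S has a good node, since it spans all nodes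
  triangle-balanced : ∀ {S v} (x y z : Edge Q) → Good S v → S (inj₁ x) → S (inj₁ y) → S (inj₁ z) →
    T (distinctPairs (pair x) (pair y) (pair z)) → BalancedCircle Q (Triple x y z)
  triangle-balanced {S} {v} x y z (good _ (_ , balanced)) Sx Sy Sz t
    with g , h , k , (C⊆T , T⊆C) ← triangle-circle x y z t =
    balanced (Triple x y z) (inj₂ (g , h , k , (C⊆T , T⊆C))) in-S (spans v)
    where
      in-S : ∀ w → Triple x y z w → S (inj₁ w)
      in-S _ (inj₁ refl) = Sx
      in-S _ (inj₂ (inj₁ refl)) = Sy
      in-S _ (inj₂ (inj₂ refl)) = Sz
      spans : ∀ u → Σ (Edge Q) λ w → Σ (Fin 3) λ u' → Triple x y z w × Inc w u' × Conn Q S u u'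
      spans zero = e g p12 , v₁ , T⊆C (inj₁ refl) , inj₁ refl , ε
      spans (suc zero) = e g p12 , v₂ , T⊆C (inj₁ refl) , inj₂ refl , ε
      spans (suc (suc zero)) = e h p23 , v₃ , T⊆C (inj₂ (inj₁ refl)) , inj₂ refl , ε

  module ShapesIn {S : Pred (Ground Q) 0ℓ} {z₁ z₂ z₃ : Ground Q} (S₁ : S z₁) (S₂ : S z₂) (S₃ : S z₃) where
    s₁ s₂ s₃ : Shape
    s₁ = shape z₁
    s₂ = shape z₂
    s₃ = shape z₃

    joins-conn : ∀ {z v w} → S z → T (joins (shape z) v w) → Conn Q S v w
    joins-conn {z} Sz t with x , refl , at-v , at-w ← joining-shape z t = incident-conn S Sz at-v at-w

    adjacent-conn : ∀ v w → T (adjacent s₁ s₂ s₃ v w) → Conn Q S v w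
    adjacent-conn v w t with split-∨ {joins s₁ v w} t
    ... | inj₁ t₁ = joins-conn S₁ t₁
    ... | inj₂ t' with split-∨ {joins s₂ v w} t'
    ... | inj₁ t₂ = joins-conn S₂ t₂
    ... | inj₂ t₃ = joins-conn S₃ t₃

    connected-conn : ∀ v w → T (connected s₁ s₂ s₃ v w) → Conn Q S v w
    connected-conn v w t with split-∨ {⌊ v ≟ w ⌋} t
    ... | inj₁ v≡w = subst (Conn Q S v) (toWitness {a? = v ≟ w} v≡w) ε
    ... | inj₂ t' with split-∨ {adjacent s₁ s₂ s₃ v w} t'
    ... | inj₁ t₁ = adjacent-conn v w t₁
    ... | inj₂ t₂ with m , t₃ ← some-sound (λ m → adjacent s₁ s₂ s₃ v m ∧ adjacent s₁ s₂ s₃ m w) t₂ =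
      let vm , mw = split-∧ {adjacent s₁ s₂ s₃ v m} t₃ in adjacent-conn v m vm ◅◅ adjacent-conn m w mw

    half-at : ∀ {z w} → S z → T (halfAt (shape z) w) → S (inj₂ w)
    half-at {inj₂ i} {w} Sz t = subst (S ∘ inj₂) (toWitness {a? = i ≟ w} t) Sz
    half-at {inj₁ (e _ _)} _ ()

    digon-at : ∀ {v w} (z z' : Ground Q) → Good S v → S z → S z' → z ≢ z' → Conn Q S v w →
      ¬ T (digonAt (shape z) (shape z') w)
    digon-at {w = w} (inj₁ (e a p)) (inj₁ (e b q)) good-v Sz Sz' z≢z' c t
      with refl ← toWitness {a? = p ≟ₚ q} (proj₁ (split-∧ {⌊ p ≟ₚ q ⌋} t)) =
      digon-blocks good-v Sz Sz' (z≢z' ∘ cong (λ g → inj₁ (e g p))) c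
        (endpoint-sound {p} (proj₂ (split-∧ {⌊ p ≟ₚ q ⌋} t)))

    no-defect : ∀ {v} → Good S v → z₁ ≢ z₂ → z₁ ≢ z₃ → z₂ ≢ z₃ → ¬ T (reachesDefect s₁ s₂ s₃ v)
    no-defect {v} good-v d₁₂ d₁₃ d₂₃ t
      with w , t' ← some-sound (λ w → connected s₁ s₂ s₃ v w ∧ defectAt s₁ s₂ s₃ w) t
      with c , defect ← split-∧ {connected s₁ s₂ s₃ v w} t'
      with split-∨ {halfAt s₁ w} defect
    ... | inj₁ h₁ = half-blocks good-v (half-at S₁ h₁) (connected-conn v w c)
    ... | inj₂ d with split-∨ {halfAt s₂ w} d
    ... | inj₁ h₂ = half-blocks good-v (half-at S₂ h₂) (connected-conn v w c)
    ... | inj₂ d with split-∨ {halfAt s₃ w} d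
    ... | inj₁ h₃ = half-blocks good-v (half-at S₃ h₃) (connected-conn v w c)
    ... | inj₂ d with split-∨ {digonAt s₁ s₂ w} d
    ... | inj₁ g₁₂ = digon-at z₁ z₂ good-v S₁ S₂ d₁₂ (connected-conn v w c) g₁₂
    ... | inj₂ d with split-∨ {digonAt s₁ s₃ w} d
    ... | inj₁ g₁₃ = digon-at z₁ z₃ good-v S₁ S₃ d₁₃ (connected-conn v w c) g₁₃
    ... | inj₂ g₂₃ = digon-at z₂ z₃ good-v S₂ S₃ d₂₃ (connected-conn v w c) g₂₃

  good-dependent : ∀ {S v} z₁ z₂ z₃ → Good S v → S z₁ → S z₂ → S z₃ → z₁ ≢ z₂ → z₁ ≢ z₃ → z₂ ≢ z₃ →
    T (dependent (shape z₁) (shape z₂) (shape z₃))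
  good-dependent {v = v} z₁ z₂ z₃ good-v S₁ S₂ S₃ d₁₂ d₁₃ d₂₃
    with split-∨ {reachesDefect (shape z₁) (shape z₂) (shape z₃) v}
           (modus-ponens (independent-unless-dependent (shape z₁) (shape z₂) (shape z₃) v)
             (both (distinct-apart z₁ z₂ d₁₂) (both (distinct-apart z₁ z₃ d₁₃) (distinct-apart z₂ z₃ d₂₃))))
  ... | inj₁ defect = ⊥-elim (ShapesIn.no-defect S₁ S₂ S₃ good-v d₁₂ d₁₃ d₂₃ defect)
  ... | inj₂ dep = dep

  -- a subset of a collinear triple leaves the opposite node isolated, hence good
  collinear-good : ∀ {S} z₁ z₂ z₃ → S ⊆ Triple z₁ z₂ z₃ → T (collinear (shape z₁) (shape z₂) (shape z₃)) →
    ∃ (Good S)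
  collinear-good {S} z₁ z₂ z₃ S⊆ t
    with P , on ← some-sound (λ P → onLine P (shape z₁) ∧ onLine P (shape z₂) ∧ onLine P (shape z₃)) t =
    third P , isolated-good S (third P) avoid
    where
      on-line : ∀ z → Triple z₁ z₂ z₃ z → T (onLine P (shape z))
      on-line _ (inj₁ refl) = proj₁ (split-∧ {onLine P (shape z₁)} on)
      on-line _ (inj₂ (inj₁ refl)) = proj₁ (split-∧ {onLine P (shape z₂)} (proj₂ (split-∧ {onLine P (shape z₁)} on)))
      on-line _ (inj₂ (inj₂ refl)) = proj₂ (split-∧ {onLine P (shape z₂)} (proj₂ (split-∧ {onLine P (shape z₁)} on)))
      avoid : ∀ z → S z → ¬ T (touches (shape z) (third P))
      avoid z Sz = refute (modus-ponens (line-avoids-third P (shape z)) (on-line z (S⊆ Sz)))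

  TriangleSet : Carrier Q → Carrier Q → Carrier Q → Pred (Ground Q) 0ℓ
  TriangleSet g h k = Triple (inj₁ (e g p12)) (inj₁ (e h p23)) (inj₁ (e k p13))

  labelOn : Carrier Q → Carrier Q → Carrier Q → Pair → Carrier Q
  labelOn g h k p12 = g
  labelOn g h k p23 = h
  labelOn g h k p13 = k

  label-in-triangle : ∀ {g h k a p} → TriangleSet g h k (inj₁ (e a p)) → a ≡ labelOn g h k p
  label-in-triangle (inj₁ refl) = refl
  label-in-triangle (inj₂ (inj₁ refl)) = refl
  label-in-triangle (inj₂ (inj₂ refl)) = refl

  -- inside a balanced triangle v₁ is good: the only circle there is the triangle itself
  triangle-good : ∀ {S g h k} → g · h ≡ k → S ⊆ TriangleSet g h k → Good S v₁
  triangle-good {S} {g} {h} {k} gh≡k S⊆ = good (λ _ _ → z≤n) (no-half , only-triangle)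
    where
      no-half : ∀ i → S (inj₂ i) → ¬ Conn Q S v₁ i
      no-half i Si with S⊆ Si
      ... | inj₁ ()
      ... | inj₂ (inj₁ ())
      ... | inj₂ (inj₂ ())
      labelled : ∀ {C : Pred (Edge Q) 0ℓ} {a p} → (∀ x → C x → S (inj₁ x)) → C (e a p) → a ≡ labelOn g h k p
      labelled sub Cx = label-in-triangle (S⊆ (sub _ Cx))
      only-triangle : ∀ C → Circle Q C → (∀ x → C x → S (inj₁ x)) →
        (Σ (Edge Q) λ x → Σ (Fin 3) λ w → C x × Inc x w × Conn Q S v₁ w) → BalancedCircle Q C
      only-triangle C (inj₁ (a , b , p , a≢b , _ , D⊆C)) sub _ =
        ⊥-elim (a≢b (trans (labelled sub (D⊆C (inj₁ refl))) (sym (labelled sub (D⊆C (inj₂ refl))))))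
      only-triangle C (inj₂ (a , b , c , C≐T)) sub _ = a , b , c , a·b≡c , C≐T
        where
          a·b≡c : a · b ≡ c
          a·b≡c = begin
            a · b ≡⟨ cong₂ _·_ (labelled sub (proj₂ C≐T (inj₁ refl))) (labelled sub (proj₂ C≐T (inj₂ (inj₁ refl)))) ⟩
            g · h ≡⟨ gh≡k ⟩
            k     ≡⟨ sym (labelled sub (proj₂ C≐T (inj₂ (inj₂ refl)))) ⟩
            c     ∎
            where open ≡-Reasoning

  HalfEdges : Pred (Ground Q) 0ℓ
  HalfEdges = Triple (inj₂ v₁) (inj₂ v₂) (inj₂ v₃)

  -- {d₁, d₂, d₃} is a basis: every node carries a half edge
  half-edges-rank : HasRank Q HalfEdges 3
  half-edges-rank = rank-3 HalfEdges λ
    { zero good-v → half-blocks good-v (inj₁ refl) ε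
    ; (suc zero) good-v → half-blocks good-v (inj₂ (inj₁ refl)) ε
    ; (suc (suc zero)) good-v → half-blocks good-v (inj₂ (inj₂ refl)) ε }

  -- a set on the line of p containing a link of p and the half edge at an end of p
  -- has rank 2: the opposite node is isolated and the ends reach the half edge
  line-rank : ∀ S p a → (∀ z → S z → T (onLine p (shape z))) → S (inj₁ (e a p)) → S (inj₂ (first p)) →
    HasRank Q S 2
  line-rank S p a on-p Sa Sd = rank-2 S (third p) (isolated-good S (third p) avoid) blocked
    where
      avoid : ∀ z → S z → ¬ T (touches (shape z) (third p))
      avoid z Sz = refute (modus-ponens (line-avoids-third p (shape z)) (on-p z Sz))
      blocked : ∀ v → v ≢ third p → ¬ Good S v
      blocked v v≢third good-v with split-∨ {⌊ v ≟ third p ⌋} (endpoint-unless-third p v)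
      ... | inj₁ v≡third = v≢third (toWitness {a? = v ≟ third p} v≡third)
      ... | inj₂ at-v = half-blocks good-v Sd (incident-conn S Sa (endpoint-sound {p} at-v) (inj₁ refl))

  first-on-line : ∀ p → T (onLine p (half (first p)))
  first-on-line p = endpoint-complete {p} (inj₁ refl)

  link-on-line : ∀ p → T (onLine p (link p))
  link-on-line p = fromWitness {a? = p ≟ₚ p} refl

  EndsAndLink : Pair → Carrier Q → Pred (Ground Q) 0ℓ
  EndsAndLink p a = Triple (inj₂ (first p)) (inj₂ (second p)) (inj₁ (e a p))

  ends-and-link-rank : ∀ p a → HasRank Q (EndsAndLink p a) 2
  ends-and-link-rank p a = line-rank (EndsAndLink p a) p a on-p (inj₂ (inj₂ refl)) (inj₁ refl)
    where
      on-p : ∀ z → EndsAndLink p a z → T (onLine p (shape z))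
      on-p _ (inj₁ refl) = first-on-line p
      on-p _ (inj₂ (inj₁ refl)) = endpoint-complete {p} (inj₂ refl)
      on-p _ (inj₂ (inj₂ refl)) = link-on-line p

  EndAndLinks : Pair → Carrier Q → Carrier Q → Pred (Ground Q) 0ℓ
  EndAndLinks p a b = Triple (inj₂ (first p)) (inj₁ (e a p)) (inj₁ (e b p))

  end-and-links-rank : ∀ p a b → HasRank Q (EndAndLinks p a b) 2
  end-and-links-rank p a b = line-rank (EndAndLinks p a b) p a on-p (inj₂ (inj₁ refl)) (inj₁ refl)
    where
      on-p : ∀ z → EndAndLinks p a b z → T (onLine p (shape z))
      on-p _ (inj₁ refl) = first-on-line p
      on-p _ (inj₂ (inj₁ refl)) = link-on-line p
      on-p _ (inj₂ (inj₂ refl)) = link-on-line p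

  -- v₂ and v₃ are joined to v₁ in a triangle, so only v₁ can be good
  triangle-only-v₁ : ∀ g h k v → v ≢ v₁ → ¬ Good (TriangleSet g h k) v
  triangle-only-v₁ g h k zero v≢v₁ _ = v≢v₁ refl
  triangle-only-v₁ g h k (suc zero) _ good-v = v₂≰v₁ (least good-v ((e g p12 , inj₁ refl , inj₂ refl) ◅ ε))
    where
      v₂≰v₁ : ¬ (v₂ ≤ v₁)
      v₂≰v₁ ()
  triangle-only-v₁ g h k (suc (suc zero)) _ good-v =
    v₃≰v₁ (least good-v ((e k p13 , inj₂ (inj₂ refl) , inj₂ refl) ◅ ε))
    where
      v₃≰v₁ : ¬ (v₃ ≤ v₁)
      v₃≰v₁ ()

  balanced-triangle-rank : ∀ g h k → g · h ≡ k → HasRank Q (TriangleSet g h k) 2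
  balanced-triangle-rank g h k gh≡k = rank-2 (TriangleSet g h k) v₁ (triangle-good gh≡k (λ m → m)) (triangle-only-v₁ g h k)

  unbalanced-triangle-rank : ∀ g h k → ¬ BalancedCircle Q (Triple (e g p12) (e h p23) (e k p13)) →
    HasRank Q (TriangleSet g h k) 3
  unbalanced-triangle-rank g h k unbalanced = rank-3 (TriangleSet g h k) λ v good-v →
    unbalanced (triangle-balanced (e g p12) (e h p23) (e k p13) good-v (inj₁ refl) (inj₂ (inj₁ refl)) (inj₂ (inj₂ refl)) _)

module Image (Q Q' : QG) (θ : Ground Q → Ground Q') (mono : MatroidMono Q Q' θ) where
  module F = Frame Q
  module F' = Frame Q'

  θ-injective : Injective _≡_ _≡_ θ
  θ-injective = proj₁ mono

  preserves-rank : ∀ {S r} → HasRank Q S r → HasRank Q' (image θ S) r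
  preserves-rank {S} {r} = proj₁ (proj₂ mono S r)

  image-apart : ∀ z z' → z ≢ z' → T (apart (shape (θ z)) (shape (θ z')))
  image-apart z z' z≢z' = distinct-apart (θ z) (θ z') (z≢z' ∘ θ-injective)

  image-good : ∀ {x y z} → HasRank Q (Triple x y z) 2 → ∃ (F'.Good (image θ (Triple x y z)))
  image-good r = F'.rank-2-some (preserves-rank r)

  in-image : ∀ {x y z w} → Triple x y z w → image θ (Triple x y z) (θ w)
  in-image m = _ , m , refl

  image-dependent : ∀ x y z → x ≢ y → x ≢ z → y ≢ z → HasRank Q (Triple x y z) 2 →
    T (dependent (shape (θ x)) (shape (θ y)) (shape (θ z)))
  image-dependent x y z x≢y x≢z y≢z r with _ , good-v ← image-good r =
    F'.good-dependent (θ x) (θ y) (θ z) good-v (in-image (inj₁ refl)) (in-image (inj₂ (inj₁ refl)))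
      (in-image (inj₂ (inj₂ refl))) (x≢y ∘ θ-injective) (x≢z ∘ θ-injective) (y≢z ∘ θ-injective)

  module Induced (a b : Carrier Q) (a≢b : a ≢ b) where

    half≢link : ∀ {i : Fin 3} {x : Edge Q} → _≢_ {A = Ground Q} (inj₂ i) (inj₁ x)
    half≢link ()

    ends≢ : ∀ p → _≢_ {A = Ground Q} (inj₂ (first p)) (inj₂ (second p))
    ends≢ p = ends-distinct p ∘ inj₂-injective

    labels≢ : ∀ p → _≢_ {A = Ground Q} (inj₁ (e a p)) (inj₁ (e b p))
    labels≢ p = a≢b ∘ cong label ∘ inj₁-injective

    hshape : Fin 3 → Shape
    hshape v = shape (θ (inj₂ v))

    -- every triple of {d_first, d_second, a e_p, b e_p} containing d_first has
    -- rank 2, so the images of the half edges at the ends of p share a line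
    ends-coline : ∀ p → T (coline (hshape (first p)) (hshape (second p)))
    ends-coline p = modus-ponens
      (dependent-triples-coline (hshape (first p)) (hshape (second p)) (shape (θ (inj₁ (e a p)))) (shape (θ (inj₁ (e b p)))))
      (both (image-apart _ _ (ends≢ p)) (both (image-apart _ _ half≢link) (both (image-apart _ _ half≢link)
        (both (image-dependent _ _ _ (ends≢ p) half≢link half≢link (F.ends-and-link-rank p a))
        (both (image-dependent _ _ _ (ends≢ p) half≢link half≢link (F.ends-and-link-rank p b))
              (image-dependent _ _ _ half≢link half≢link (labels≢ p) (F.end-and-links-rank p a b)))))))

    -- {d₁, d₂, d₃} has rank 3, so its image is not collinear
    halves-not-collinear : ¬ T (collinear (hshape v₁) (hshape v₂) (hshape v₃))
    halves-not-collinear t with _ , good-v ← F'.collinear-good _ _ _ (proj₁ (image-triple θ ≐-refl)) t =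
      F'.rank-3-none (preserves-rank F.half-edges-rank) good-v

    halves-to-halves : T (isHalf (hshape v₁) ∧ isHalf (hshape v₂) ∧ isHalf (hshape v₃))
    halves-to-halves = modus-ponens (pairwise-coline-halves (hshape v₁) (hshape v₂) (hshape v₃))
      (both (ends-coline p12) (both (ends-coline p13) (both (ends-coline p23) (affirm-not halves-not-collinear))))

    -- kept opaque so that the node and edge maps never unfold into the
    -- exhaustive checks they are obtained from
    opaque
      half-image : ∀ v → ∃ λ i → θ (inj₂ v) ≡ inj₂ i
      half-image v = half-shape (θ (inj₂ v)) (is-half v)
        where
          is-half : ∀ v → T (isHalf (hshape v))
          is-half zero = proj₁ (split-∧ {isHalf (hshape v₁)} halves-to-halves)
          is-half (suc zero) = proj₁ (split-∧ {isHalf (hshape v₂)} (proj₂ (split-∧ {isHalf (hshape v₁)} halves-to-halves)))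
          is-half (suc (suc zero)) = proj₂ (split-∧ {isHalf (hshape v₂)} (proj₂ (split-∧ {isHalf (hshape v₁)} halves-to-halves)))

    node : Fin 3 → Fin 3
    node v = proj₁ (half-image v)

    θ-half : ∀ v → θ (inj₂ v) ≡ inj₂ (node v)
    θ-half v = proj₂ (half-image v)

    node-injective : Injective _≡_ _≡_ node
    node-injective {v} {w} eq = inj₂-injective (θ-injective (trans (θ-half v) (trans (cong inj₂ eq) (sym (θ-half w)))))

    -- {d_first, d_second, g e_p} has rank 2, so θ(g e_p) is a link joining the
    -- images of the ends of p
    opaque
      link-image : ∀ x → ∃ λ y → (θ (inj₁ x) ≡ inj₁ y) × Inc y (node (first (pair x))) × Inc y (node (second (pair x)))
      link-image (e g p) = joining-shape (θ (inj₁ (e g p))) (modus-ponens (dependent-on-halves-joins i j s)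
        (both (fromWitnessFalse {a? = i ≟ j} (ends-distinct p ∘ node-injective))
        (both (subst (λ t → T (apart t s)) (cong shape (θ-half (first p))) (image-apart _ _ half≢link))
        (both (subst (λ t → T (apart t s)) (cong shape (θ-half (second p))) (image-apart _ _ half≢link))
              (subst₂ (λ t t' → T (dependent t t' s)) (cong shape (θ-half (first p))) (cong shape (θ-half (second p)))
                (image-dependent _ _ _ (ends≢ p) half≢link half≢link (F.ends-and-link-rank p g)))))))
        where
          i j : Fin 3
          i = node (first p)
          j = node (second p)
          s : Shape
          s = shape (θ (inj₁ (e g p)))

    edge : Edge Q → Edge Q'
    edge x = proj₁ (link-image x)

    agrees : ∀ x → θ (inj₁ x) ≡ inj₁ (edge x)
    agrees x = proj₁ (proj₂ (link-image x))

    edge-injective : Injective _≡_ _≡_ edge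
    edge-injective {x} {x'} eq = inj₁-injective (θ-injective (trans (agrees x) (trans (cong inj₁ eq) (sym (agrees x')))))

    incid : ∀ x v → Inc x v → Inc (edge x) (node v)
    incid (e g p) v (inj₁ refl) = proj₁ (proj₂ (proj₂ (link-image (e g p))))
    incid (e g p) v (inj₂ refl) = proj₂ (proj₂ (proj₂ (link-image (e g p))))

    joins-image : ∀ x v w → Inc x v → Inc x w → T (joins (link (pair (edge x))) (node v) (node w))
    joins-image x v w at-v at-w = both (incident-endpoint (edge x) (incid x v at-v)) (incident-endpoint (edge x) (incid x w at-w))

    parallel-images : ∀ g h p → pair (edge (e g p)) ≡ pair (edge (e h p))
    parallel-images g h p = toWitness {a? = pair (edge (e g p)) ≟ₚ pair (edge (e h p))}
      (modus-ponens (pair-determined (node (first p)) (node (second p)) (pair (edge (e g p))) (pair (edge (e h p))))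
        (both (fromWitnessFalse {a? = node (first p) ≟ node (second p)} (ends-distinct p ∘ node-injective))
        (both (joins-image (e g p) _ _ (inj₁ refl) (inj₂ refl)) (joins-image (e h p) _ _ (inj₁ refl) (inj₂ refl)))))

    links≢ : ∀ {x x'} → pair x ≢ pair x' → _≢_ {A = Ground Q'} (inj₁ (edge x)) (inj₁ (edge x'))
    links≢ {x} {x'} p≢p' eq = p≢p' (cong pair (edge-injective {x} {x'} (inj₁-injective eq)))

    -- a balanced triangle has rank 2, so its image is dependent; being a triangle of
    -- links around three distinct nodes it is not collinear, hence a balanced circle
    bal : ∀ C → Circle Q C → BalancedCircle Q C → BalancedCircle Q' (image edge C)
    bal C _ (g , h , k , gh≡k , C≐T) with _ , good-v ← image-good (F.balanced-triangle-rank g h k gh≡k) =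
      F'.balanced-resp (≐-sym (image-triple edge C≐T))
        (F'.triangle-balanced (edge x₁) (edge x₂) (edge x₃) good-v (member (inj₁ refl)) (member (inj₂ (inj₁ refl)))
          (member (inj₂ (inj₂ refl))) is-triangle)
      where
        x₁ x₂ x₃ : Edge Q
        x₁ = e g p12
        x₂ = e h p23
        x₃ = e k p13
        member : ∀ {x} → F.TriangleSet g h k (inj₁ x) → image θ (F.TriangleSet g h k) (inj₁ (edge x))
        member {x} m = inj₁ x , m , agrees x
        dep : T (dependent (link (pair (edge x₁))) (link (pair (edge x₂))) (link (pair (edge x₃))))
        dep = F'.good-dependent (inj₁ (edge x₁)) (inj₁ (edge x₂)) (inj₁ (edge x₃)) good-v
          (member (inj₁ refl)) (member (inj₂ (inj₁ refl))) (member (inj₂ (inj₂ refl)))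
          (links≢ λ ()) (links≢ λ ()) (links≢ λ ())
        not-collinear : T (not (collinear (link (pair (edge x₁))) (link (pair (edge x₂))) (link (pair (edge x₃)))))
        not-collinear = modus-ponens
          (links-around-not-collinear (node v₁) (node v₂) (node v₃) (pair (edge x₁)) (pair (edge x₂)) (pair (edge x₃)))
          (both (distinct-image node-injective v₁ v₂ v₃ _)
          (both (joins-image x₁ v₁ v₂ (inj₁ refl) (inj₂ refl))
          (both (joins-image x₂ v₂ v₃ (inj₁ refl) (inj₂ refl)) (joins-image x₃ v₁ v₃ (inj₁ refl) (inj₂ refl)))))
        is-triangle : T (distinctPairs (pair (edge x₁)) (pair (edge x₂)) (pair (edge x₃)))
        is-triangle with split-∨ {collinear (link (pair (edge x₁))) (link (pair (edge x₂))) (link (pair (edge x₃)))} dep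
        ... | inj₁ col = ⊥-elim (refute not-collinear col)
        ... | inj₂ tri = tri

    -- the image of a digon lies on one pair, so it is no triangle; an unbalanced
    -- triangle has rank 3, which a balanced image triangle would lower to 2
    unbal : ∀ C → Circle Q C → ¬ BalancedCircle Q C → ¬ BalancedCircle Q' (image edge C)
    unbal C (inj₁ (g , h , p , _ , C⊆D , _)) _ (_ , _ , _ , _ , _ , T⊆I) =
      p12≢p23 (trans (on-pair (T⊆I (inj₁ refl))) (sym (on-pair (T⊆I (inj₂ (inj₁ refl))))))
      where
        p12≢p23 : p12 ≢ p23
        p12≢p23 ()
        on-pair : ∀ {y} → image edge C y → pair y ≡ pair (edge (e g p))
        on-pair (x , Cx , refl) with C⊆D Cx
        ... | inj₁ refl = refl
        ... | inj₂ refl = parallel-images h g p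
    unbal C (inj₂ (g , h , k , C≐T)) unbalanced (g' , h' , k' , g'h'≡k' , I≐T) =
      F'.rank-3-none (preserves-rank (F.unbalanced-triangle-rank g h k (unbalanced ∘ F.balanced-resp (≐-sym C≐T))))
        (F'.triangle-good g'h'≡k' inside)
      where
        edge-inside : ∀ x → C x → F'.TriangleSet g' h' k' (θ (inj₁ x))
        edge-inside x Cx = subst (F'.TriangleSet g' h' k') (sym (agrees x)) (inj₁-triple (proj₁ I≐T (x , Cx , refl)))
        inside : image θ (F.TriangleSet g h k) ⊆ F'.TriangleSet g' h' k'
        inside m with proj₁ (image-triple θ ≐-refl) m
        ... | inj₁ refl = edge-inside _ (proj₂ C≐T (inj₁ refl))
        ... | inj₂ (inj₁ refl) = edge-inside _ (proj₂ C≐T (inj₂ (inj₁ refl)))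
        ... | inj₂ (inj₂ refl) = edge-inside _ (proj₂ C≐T (inj₂ (inj₂ refl)))

    induced : BGMono Q Q'
    induced = record
      { node = node ; edge = edge ; node-inj = node-injective ; edge-inj = edge-injective
      ; incid = incid ; bal = bal ; unbal = unbal }

    induced-agrees : Agrees θ induced
    induced-agrees = agrees

-- A biased-graph monomorphism of ⟨QK₃⟩ with Q nonempty is determined by its
-- action on links: node v is the only common end of the images of two links at v.
determined-by-edges : ∀ {Q Q'} → Carrier Q → (φ ψ : BGMono Q Q') →
  (∀ x → BGMono.edge φ x ≡ BGMono.edge ψ x) → SameMono φ ψ
determined-by-edges {Q} {Q'} a φ ψ same-edges = same-node , same-edges
  where
    open BGMono

    image-end : ∀ (χ : BGMono Q Q') x {v} → Inc x v → T (endpoint (pair (edge χ x)) (node χ v))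
    image-end χ x inc = incident-endpoint (edge χ x) (incid χ x _ inc)

    meet : ∀ x₁ x₂ v u₁ u₂ → T (distinctNodes v u₁ u₂) →
      Inc x₁ v → Inc x₁ u₁ → Inc x₂ v → Inc x₂ u₂ → node φ v ≡ node ψ v
    meet x₁ x₂ v u₁ u₂ distinct x₁-v x₁-u₁ x₂-v x₂-u₂ = sym (toWitness {a? = node ψ v ≟ node φ v}
      (modus-ponens (links-meet-once (node φ v) (node φ u₁) (node φ u₂) (node ψ v) (pair (edge φ x₁)) (pair (edge φ x₂)))
        (both (distinct-image (node-inj φ) v u₁ u₂ distinct)
        (both (both (image-end φ x₁ x₁-v) (image-end φ x₁ x₁-u₁))
        (both (both (image-end φ x₂ x₂-v) (image-end φ x₂ x₂-u₂))
        (both (ψ-end x₁ x₁-v) (ψ-end x₂ x₂-v)))))))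
      where
        ψ-end : ∀ x → Inc x v → T (endpoint (pair (edge φ x)) (node ψ v))
        ψ-end x inc = subst (λ y → T (endpoint (pair y) (node ψ v))) (sym (same-edges x)) (image-end ψ x inc)

    same-node : ∀ v → node φ v ≡ node ψ v
    same-node zero = meet (e a p12) (e a p13) v₁ v₂ v₃ _ (inj₁ refl) (inj₂ refl) (inj₁ refl) (inj₂ refl)
    same-node (suc zero) = meet (e a p12) (e a p23) v₂ v₁ v₃ _ (inj₂ refl) (inj₁ refl) (inj₁ refl) (inj₂ refl)
    same-node (suc (suc zero)) = meet (e a p13) (e a p23) v₃ v₁ v₂ _ (inj₂ refl) (inj₁ refl) (inj₂ refl) (inj₁ refl)

IsLink : ∀ {Q} → Ground Q → Set
IsLink z = ∃ λ x → z ≡ inj₁ x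

is-link? : ∀ {Q} (z : Ground Q) → Dec (IsLink z)
is-link? (inj₁ x) = yes (x , refl)
is-link? (inj₂ _) = no λ ()

half-index : ∀ {Q} (z : Ground Q) → ¬ IsLink z → Fin 3
half-index (inj₁ x) not-link = ⊥-elim (not-link (x , refl))
half-index (inj₂ i) _ = i

as-half : ∀ {Q} (z : Ground Q) not-link → z ≡ inj₂ (half-index z not-link)
as-half (inj₁ x) not-link = ⊥-elim (not-link (x , refl))
as-half (inj₂ i) _ = refl

-- Ḡ(QK₃) has only three half edges, so four distinct elements include a link
link-among-four : ∀ {Q} (f : Fin 4 → Ground Q) → Injective _≡_ _≡_ f → ∃ λ i → IsLink (f i)
link-among-four f f-inj with any? (λ i → is-link? (f i))
... | yes found = found
... | no none with i , j , i<j , same ← pigeonhole (n<1+n 3) (λ i → half-index (f i) (λ l → none (i , l))) =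
  ⊥-elim (<⇒≢ i<j (f-inj (trans (as-half (f i) _) (trans (cong inj₂ same) (sym (as-half (f j) _))))))

-- the one-element ⟨QK₃⟩ is a single balanced triangle; it embeds in ⟨Q'K₃⟩ as
-- the balanced triangle {c e₁₂, c e₂₃, (c·c) e₁₃}, for any c in Q'
trivial-embedding : ∀ {Q Q'} → ExactlyOne Q → Carrier Q' → BGMono Q Q'
trivial-embedding {Q} {Q'} (a , unique) c = record
  { node = λ v → v ; edge = edge ; node-inj = λ eq → eq ; edge-inj = edge-injective
  ; incid = λ { (e _ _) v inc → inc }
  ; bal = λ { C _ (g , h , k , _ , C≐T) → c , c , c · c , refl , image-triple edge C≐T }
  ; unbal = λ C circle unbalanced _ → unbalanced (all-balanced C circle) }
  where
    open QG Q' using (_·_)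

    edge : Edge Q → Edge Q'
    edge (e _ p) = e (Frame.labelOn Q' c c (c · c) p) p

    edge-injective : Injective _≡_ _≡_ edge
    edge-injective {e g p} {e h .p} refl = cong (λ t → e t p) (trans (unique g) (sym (unique h)))

    all-balanced : ∀ C → Circle Q C → BalancedCircle Q C
    all-balanced C (inj₁ (g , h , _ , g≢h , _)) = ⊥-elim (g≢h (trans (unique g) (sym (unique h))))
    all-balanced C (inj₂ (g , h , k , C≐T)) = g , h , k , trans (unique _) (sym (unique k)) , C≐T

four-elements : ∀ Q → Carrier Q → Fin 4 → Ground Q
four-elements Q a zero = inj₁ (e a p12)
four-elements Q a (suc i) = inj₂ i

four-elements-injective : ∀ Q (a : Carrier Q) → Injective _≡_ _≡_ (four-elements Q a)
four-elements-injective Q a {zero} {zero} _ = refl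
four-elements-injective Q a {suc i} {suc j} eq = cong suc (inj₂-injective eq)

-- when Q has one element, θ still provides an element of Q': among the images of
-- four distinct elements there is a link, and its label will do
one-element-case : ∀ {Q Q'} (θ : Ground Q → Ground Q') → MatroidMono Q Q' θ → ExactlyOne Q → BGMono Q Q'
one-element-case {Q} θ (θ-injective , _) (a , unique)
  with _ , y , _ ← link-among-four (θ ∘ four-elements Q a) (four-elements-injective Q a ∘ θ-injective) =
  trivial-embedding (a , unique) (label y)

proposition2p8 : (Q Q' : QG) (θ : Ground Q → Ground Q') → MatroidMono Q Q' θ →
    (MoreThanOne Q →
      Σ (BGMono Q Q') (Agrees θ) ×
      (∀ (φ ψ : BGMono Q Q') → Agrees θ φ → Agrees θ ψ → SameMono φ ψ)) ×
    (ExactlyOne Q → BGMono Q Q')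
proposition2p8 Q Q' θ mono = more-than-one , one-element-case θ mono
  where
    more-than-one : MoreThanOne Q →
      Σ (BGMono Q Q') (Agrees θ) × (∀ (φ ψ : BGMono Q Q') → Agrees θ φ → Agrees θ ψ → SameMono φ ψ)
    more-than-one (a , b , a≢b) =
        (induced , induced-agrees)
      , λ φ ψ θ≈φ θ≈ψ → determined-by-edges a φ ψ (λ x → inj₁-injective (trans (sym (θ≈φ x)) (θ≈ψ x)))
      where open Image.Induced Q Q' θ mono a b a≢b
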